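{- For every $\varepsilon>0$ there exists $t_0\in\mathbb N$ such that for all integers $t\geq t_0$ there is a sequence of integers $0=n_1<n_2<\dots<n_k=t$ (for some $k$) such that for all $j\in\{1,\dots,k-1\}$, \[ \frac1t\bigl(n_{j+1}(t-n_j)+(t-n_{j+1})\bigr)\leq \left(\frac14+\varepsilon\right)t. \]
   Formalization: The parameter ε ranges over the positive rationals. -}

module Defs where

open import Data.Nat using (ℕ; suc; _∸_)
open import Data.Fin using (Fin; zero; inject₁; fromℕ)
import Data.Fin as Fin
open import Data.Rational using (ℚ; _+_; _*_; _≤_; 1ℚ; _/_)
open import Data.Product using (_×_)
open import Relation.Binary.PropositionalEquality using (_≡_)
import Data.Nat as ℕ
import Data.Integer

quarter : ℚ
quarter = Data.Integer.+ 1 / 4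

toℚ : ℕ → ℚ
toℚ n = Data.Integer.+ n / 1

-- A sequence 0 = n_1 < n_2 < ... < n_k = t, given as n : Fin k' → ℕ with k' = suc m
-- (indices 0..m, so k = m+1), satisfying the bound
--   n_{j+1} (t - n_j) + (t - n_{j+1}) ≤ (1/4 + ε) t²
-- for each consecutive pair (this is the paper's inequality multiplied by t).
GoodSeq : ℚ → ℕ → (m : ℕ) → (Fin (suc m) → ℕ) → Set
GoodSeq ε t m n =
  (n zero ≡ 0) × (n (fromℕ m) ≡ t) ×
  ((j : Fin m) → n (inject₁ j) ℕ.< n (Fin.suc j)) ×
  ((j : Fin m) →
     toℚ (n (Fin.suc j) ℕ.* (t ∸ n (inject₁ j)) ℕ.+ (t ∸ n (Fin.suc j)))
       ≤ (quarter + ε) * toℚ t * toℚ t)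

{-# OPTIONS --safe #-}
module Submission where

-- Take every integer 0, 1, …, t as the sequence.  The step from a to a + 1 costs
-- (a+1)(t−a) + (t−a−1), and 4(a+1)(t−a) ≤ (t+1)² by AM–GM, so four times the cost is
-- at most t² + 8t.  Writing ε = P/D, this is at most 4(1/4 + ε)t² as soon as t ≥ 2D.

open import Defs
open import Data.Nat using (ℕ; suc; _≥_)
open import Data.Fin using (Fin)
open import Data.Rational using (ℚ; 0ℚ; _<_)
open import Data.Product using (Σ; ∃; ∃-syntax)

open import Data.Nat as ℕ using (zero; _∸_; _+_; _*_; _≤_; NonZero)
open import Data.Nat.Properties
open import Data.Nat.Solver using (module +-*-Solver)
open import Data.Fin as Fin using (toℕ; inject₁)
open import Data.Fin.Properties using (toℕ-inject₁; toℕ-fromℕ; toℕ<n)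
open import Data.Integer as ℤ using (+_; +[1+_]; -[1+_]; +≤+)
import Data.Integer.Properties as ℤ
import Data.Rational as ℚ
open import Data.Rational.Properties using (toℚᵘ-cancel-≤; toℚᵘ-homo-+; toℚᵘ-homo-*; normalize-coprime)
open import Data.Rational.Unnormalised as ℚᵘ using (mkℚᵘ; *≤*)
import Data.Rational.Unnormalised.Properties as ℚᵘ
open import Data.Nat.Coprimality using (Coprime; 1-coprimeTo) renaming (sym to Coprime-sym)
open import Data.Product using (_,_)
open import Data.Sum using (inj₁; inj₂)
open import Relation.Binary.PropositionalEquality

open +-*-Solver

4*[m*n]≤[m+n]*[m+n]-ordered : ∀ {m n} → m ≤ n → 4 * (m * n) ≤ (m + n) * (m + n)
4*[m*n]≤[m+n]*[m+n]-ordered {m} m≤n with m≤n⇒∃[o]m+o≡n m≤n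
... | e , refl = subst (4 * (m * (m + e)) ≤_) (square-of-sum m e) (m≤m+n _ (e * e))
  where
  square-of-sum : ∀ m e → 4 * (m * (m + e)) + e * e ≡ (m + (m + e)) * (m + (m + e))
  square-of-sum = solve 2 (λ m e → con 4 :* (m :* (m :+ e)) :+ e :* e
                                 := (m :+ (m :+ e)) :* (m :+ (m :+ e))) refl

4*[m*n]≤[m+n]*[m+n] : ∀ m n → 4 * (m * n) ≤ (m + n) * (m + n)
4*[m*n]≤[m+n]*[m+n] m n with ≤-total m n
... | inj₁ m≤n = 4*[m*n]≤[m+n]*[m+n]-ordered m≤n
... | inj₂ n≤m = subst₂ _≤_ (cong (4 *_) (*-comm n m)) (cong (λ s → s * s) (+-comm n m))
                   (4*[m*n]≤[m+n]*[m+n]-ordered n≤m)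

stepCost : ℕ → ℕ → ℕ → ℕ
stepCost t u v = v * (t ∸ u) + (t ∸ v)

stepCost-unit : ∀ a r → stepCost (suc a + r) a (suc a) ≡ suc a * suc r + r
stepCost-unit a r = cong₂ (λ x y → suc a * x + y) 1+a+r∸a≡1+r (m+n∸m≡n (suc a) r)
  where
  1+a+r∸a≡1+r : suc a + r ∸ a ≡ suc r
  1+a+r∸a≡1+r = trans (cong (_∸ a) (sym (+-suc a r))) (m+n∸m≡n a (suc r))

4*stepCost-unit≤t*t+8*t : ∀ {a t} → a ℕ.< t → 4 * stepCost t a (suc a) ≤ t * t + 8 * t
4*stepCost-unit≤t*t+8*t {a} a<t with m≤n⇒∃[o]m+o≡n a<t
... | r , refl = begin
  4 * stepCost t a (suc a)                           ≡⟨ cong (4 *_) (stepCost-unit a r) ⟩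
  4 * (suc a * suc r + r)                            ≡⟨ *-distribˡ-+ 4 (suc a * suc r) r ⟩
  4 * (suc a * suc r) + 4 * r                        ≤⟨ +-monoˡ-≤ (4 * r) (4*[m*n]≤[m+n]*[m+n] (suc a) (suc r)) ⟩
  (suc a + suc r) * (suc a + suc r) + 4 * r          ≤⟨ m≤m+n _ (5 + 6 * a + 2 * r) ⟩
  -- the slack is t² + 8t − (t + 1)² − 4r
  (suc a + suc r) * (suc a + suc r) + 4 * r + (5 + 6 * a + 2 * r) ≡⟨ slack a r ⟩
  t * t + 8 * t                                      ∎
  where
  open ≤-Reasoning
  t = suc a + r
  slack : ∀ a r → (suc a + suc r) * (suc a + suc r) + 4 * r + (5 + 6 * a + 2 * r)
                ≡ (suc a + r) * (suc a + r) + 8 * (suc a + r)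
  slack = solve 2 (λ a r → ((con 1 :+ a) :+ (con 1 :+ r)) :* ((con 1 :+ a) :+ (con 1 :+ r)) :+ con 4 :* r
                             :+ (con 5 :+ con 6 :* a :+ con 2 :* r)
                        := (con 1 :+ a :+ r) :* (con 1 :+ a :+ r) :+ con 8 :* (con 1 :+ a :+ r)) refl

c*[4*D]≤[D+P*4]*t*t : ∀ {c t D} P .{{_ : NonZero P}} → 4 * c ≤ t * t + 8 * t → 2 * D ≤ t →
                      c * (4 * D) ≤ (D + P * 4) * t * t
c*[4*D]≤[D+P*4]*t*t {c} {t} {D} P 4c≤t²+8t 2D≤t = begin
  c * (4 * D)                    ≡⟨ regroup₁ c D ⟩
  4 * c * D                      ≤⟨ *-monoˡ-≤ D 4c≤t²+8t ⟩
  (t * t + 8 * t) * D            ≡⟨ regroup₂ t D ⟩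
  t * t * D + 4 * t * (2 * D)    ≤⟨ +-monoʳ-≤ (t * t * D) (*-monoʳ-≤ (4 * t) 2D≤t) ⟩
  t * t * D + 4 * t * t          ≤⟨ +-monoʳ-≤ (t * t * D) (m≤m*n (4 * t * t) P) ⟩
  t * t * D + 4 * t * t * P      ≡⟨ regroup₃ t D P ⟩
  (D + P * 4) * t * t            ∎
  where
  open ≤-Reasoning
  regroup₁ : ∀ c D → c * (4 * D) ≡ 4 * c * D
  regroup₁ = solve 2 (λ c D → c :* (con 4 :* D) := con 4 :* c :* D) refl
  regroup₂ : ∀ t D → (t * t + 8 * t) * D ≡ t * t * D + 4 * t * (2 * D)
  regroup₂ = solve 2 (λ t D → (t :* t :+ con 8 :* t) :* D := t :* t :* D :+ con 4 :* t :* (con 2 :* D)) refl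
  regroup₃ : ∀ t D P → t * t * D + 4 * t * t * P ≡ (D + P * 4) * t * t
  regroup₃ = solve 3 (λ t D P → t :* t :* D :+ con 4 :* t :* t :* P := (D :+ P :* con 4) :* t :* t) refl

toℚᵘ-toℚ : ∀ n → ℚ.toℚᵘ (toℚ n) ≡ mkℚᵘ (+ n) 0
toℚᵘ-toℚ n = cong ℚ.toℚᵘ (normalize-coprime (Coprime-sym (1-coprimeTo n)))

-- In ℚᵘ the right-hand side is the unreduced fraction ((d+1) + 4(p+1)) t² / (4(d+1)).
[¼+ε]*t*t-cross : ∀ p d c t → c * (4 * suc d) ≤ (suc d + suc p * 4) * t * t →
                  mkℚᵘ (+ c) 0 ℚᵘ.≤ (mkℚᵘ (+ 1) 3 ℚᵘ.+ mkℚᵘ +[1+ p ] d) ℚᵘ.* mkℚᵘ (+ t) 0 ℚᵘ.* mkℚᵘ (+ t) 0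
[¼+ε]*t*t-cross p d c t h = *≤* (subst₂ ℤ._≤_ lhs rhs (+≤+ h))
  where
  open ≡-Reasoning
  D = suc d
  P = suc p
  lhs : + (c * (4 * D)) ≡ + c ℤ.* + (4 * D * 1 * 1)
  lhs = trans (ℤ.pos-* c (4 * D)) (cong (λ x → + c ℤ.* + x) (sym (trans (*-identityʳ _) (*-identityʳ _))))
  rhs : + ((D + P * 4) * t * t) ≡ (+ 1 ℤ.* + D ℤ.+ + P ℤ.* + 4) ℤ.* + t ℤ.* + t ℤ.* + 1
  rhs = begin
    + ((D + P * 4) * t * t)                          ≡⟨ ℤ.pos-* ((D + P * 4) * t) t ⟩
    + ((D + P * 4) * t) ℤ.* + t                      ≡⟨ cong (ℤ._* + t) (ℤ.pos-* (D + P * 4) t) ⟩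
    + (D + P * 4) ℤ.* + t ℤ.* + t                    ≡⟨ cong (λ x → x ℤ.* + t ℤ.* + t) (ℤ.pos-+ D (P * 4)) ⟩
    (+ D ℤ.+ + (P * 4)) ℤ.* + t ℤ.* + t              ≡⟨ cong (λ x → (x ℤ.+ + (P * 4)) ℤ.* + t ℤ.* + t) (sym (ℤ.*-identityˡ (+ D))) ⟩
    (+ 1 ℤ.* + D ℤ.+ + (P * 4)) ℤ.* + t ℤ.* + t      ≡⟨ cong (λ x → (+ 1 ℤ.* + D ℤ.+ x) ℤ.* + t ℤ.* + t) (ℤ.pos-* P 4) ⟩
    (+ 1 ℤ.* + D ℤ.+ + P ℤ.* + 4) ℤ.* + t ℤ.* + t    ≡⟨ sym (ℤ.*-identityʳ _) ⟩
    (+ 1 ℤ.* + D ℤ.+ + P ℤ.* + 4) ℤ.* + t ℤ.* + t ℤ.* + 1 ∎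

toℚ-≤-[¼+ε]*t*t : ∀ p d .(cop : Coprime (suc p) (suc d)) c t →
                  c * (4 * suc d) ≤ (suc d + suc p * 4) * t * t →
                  toℚ c ℚ.≤ (quarter ℚ.+ ℚ.mkℚ +[1+ p ] d cop) ℚ.* toℚ t ℚ.* toℚ t
toℚ-≤-[¼+ε]*t*t p d cop c t h = toℚᵘ-cancel-≤ (begin
  ℚ.toℚᵘ (toℚ c)                                   ≡⟨ toℚᵘ-toℚ c ⟩
  mkℚᵘ (+ c) 0                                     ≤⟨ [¼+ε]*t*t-cross p d c t h ⟩
  (¼ ℚᵘ.+ εᵘ) ℚᵘ.* mkℚᵘ (+ t) 0 ℚᵘ.* mkℚᵘ (+ t) 0  ≡⟨ cong (λ x → (¼ ℚᵘ.+ εᵘ) ℚᵘ.* x ℚᵘ.* x) (sym (toℚᵘ-toℚ t)) ⟩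
  (¼ ℚᵘ.+ εᵘ) ℚᵘ.* ℚ.toℚᵘ T ℚᵘ.* ℚ.toℚᵘ T          ≃⟨ homo ⟨
  ℚ.toℚᵘ ((quarter ℚ.+ ε) ℚ.* T ℚ.* T)             ∎)
  where
  open ℚᵘ.≤-Reasoning
  ε = ℚ.mkℚ +[1+ p ] d cop
  εᵘ = ℚ.toℚᵘ ε
  ¼ = ℚ.toℚᵘ quarter
  T = toℚ t
  homo : ℚ.toℚᵘ ((quarter ℚ.+ ε) ℚ.* T ℚ.* T) ℚᵘ.≃ (¼ ℚᵘ.+ εᵘ) ℚᵘ.* ℚ.toℚᵘ T ℚᵘ.* ℚ.toℚᵘ T
  homo = ℚᵘ.≃-trans (toℚᵘ-homo-* ((quarter ℚ.+ ε) ℚ.* T) T)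
           (ℚᵘ.*-congʳ (ℚᵘ.≃-trans (toℚᵘ-homo-* (quarter ℚ.+ ε) T) (ℚᵘ.*-congʳ (toℚᵘ-homo-+ quarter ε))))

lemma2p1 : (ε : ℚ) → 0ℚ < ε → ∃[ t₀ ] ((t : ℕ) → t ≥ t₀ → ∃[ m ] Σ (Fin (suc m) → ℕ) (λ n → GoodSeq ε t m n))
lemma2p1 (ℚ.mkℚ +[1+ p ] d cop) _ =
  2 * suc d , λ t t≥2D → t , toℕ , refl , toℕ-fromℕ t , increasing , cost-bound t t≥2D
  where
  increasing : ∀ {t} (j : Fin t) → toℕ (inject₁ j) ℕ.< toℕ (Fin.suc j)
  increasing j = ≤-reflexive (cong suc (toℕ-inject₁ j))
  cost-bound : ∀ t → t ≥ 2 * suc d → (j : Fin t) →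
               toℚ (stepCost t (toℕ (inject₁ j)) (toℕ (Fin.suc j)))
                 ℚ.≤ (quarter ℚ.+ ℚ.mkℚ +[1+ p ] d cop) ℚ.* toℚ t ℚ.* toℚ t
  cost-bound t t≥2D j rewrite toℕ-inject₁ j =
    toℚ-≤-[¼+ε]*t*t p d cop c t
      (c*[4*D]≤[D+P*4]*t*t {c} {D = suc d} (suc p) (4*stepCost-unit≤t*t+8*t (toℕ<n j)) t≥2D)
    where c = stepCost t (toℕ j) (suc (toℕ j))
lemma2p1 (ℚ.mkℚ (+ zero) _ _) (ℚ.*<* (ℤ.+<+ ()))
lemma2p1 (ℚ.mkℚ -[1+ _ ] _ _) (ℚ.*<* ())
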